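{- Let $U$ be a group on which $SL(2,\mathbb{Z})$ acts from the left by group automorphisms $u\mapsto g[u]$, let $U_+$ be the subgroup of elements fixed by $-I$, and let $M_U(SL(2,\mathbb{Z}))$ be the set of $U$-valued pseudo-measures $J$ that are modular, i.e. $J(g\alpha,g\beta)=g[J(\alpha,\beta)]$ for all $g\in SL(2,\mathbb{Z})$, $\alpha,\beta\in\mathbf{P}^1(\mathbb{Q})$. Define $\varphi:U_+\to U_+\times U_+$ by $\varphi(u)=(\sigma[u]\cdot u,\ \tau^2[u]\cdot\tau[u]\cdot u)$. Then $J\mapsto J(\infty,0)$ is a bijection $M_U(SL(2,\mathbb{Z}))\cong\varphi^{ -1}(1_U,1_U)$.
   Context: $\mathbf{P}^1(\mathbb{Q})=\mathbb{Q}\cup\{\infty\}$ with fractional linear action. A $U$-valued pseudo-measure is a function $J:\mathbf{P}^1(\mathbb{Q})^2\to U$ with $J(\alpha,\alpha)=1$, $J(\beta,\alpha)J(\alpha,\beta)=1$, $J(\gamma,\alpha)J(\beta,\gamma)J(\alpha,\beta)=1$ for all $\alpha,\beta,\gamma$ (here $J(\alpha,\beta)$ is the value on the segment with ingoing end $\alpha$ and outgoing end $\beta$). $\sigma=\begin{pmatrix}0&-1\\1&0\end{pmatrix}$, $\tau=\begin{pmatrix}0&-1\\1&-1\end{pmatrix}$; $U_+$ is regarded as a $PSL(2,\mathbb{Z})$-group. -}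

module Defs where

open import Level using (Level; _⊔_)
open import Data.Integer as ℤ using (ℤ; +_; -[1+_])
open import Data.Integer.Tactic.RingSolver using (solve-∀)
open import Data.Rational as ℚ using (ℚ)
open import Data.Rational.Properties as ℚP using ()
open import Data.Product using (Σ; _×_; _,_; ∃)
open import Relation.Nullary using (yes; no)
open import Relation.Binary.PropositionalEquality
  using (_≡_; refl; cong₂; trans)
open import Algebra.Bundles using (Group)

data P1 : Set where
  fin : ℚ → P1
  ∞   : P1

record SL2Z : Set where
  constructor mat
  field
    a b c d : ℤ
    det : a ℤ.* d ℤ.- b ℤ.* c ≡ + 1

private
  det-lemma : ∀ (a b c d e f g h : ℤ) →
    (a ℤ.* e ℤ.+ b ℤ.* g) ℤ.* (c ℤ.* f ℤ.+ d ℤ.* h)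
      ℤ.- (a ℤ.* f ℤ.+ b ℤ.* h) ℤ.* (c ℤ.* e ℤ.+ d ℤ.* g)
    ≡ (a ℤ.* d ℤ.- b ℤ.* c) ℤ.* (e ℤ.* h ℤ.- f ℤ.* g)
  det-lemma = solve-∀

_·_ : SL2Z → SL2Z → SL2Z
mat a b c d p · mat e f g h q =
  mat (a ℤ.* e ℤ.+ b ℤ.* g) (a ℤ.* f ℤ.+ b ℤ.* h)
      (c ℤ.* e ℤ.+ d ℤ.* g) (c ℤ.* f ℤ.+ d ℤ.* h)
      (trans (det-lemma a b c d e f g h) (cong₂ ℤ._*_ p q))

I : SL2Z
I = mat (+ 1) (+ 0) (+ 0) (+ 1) refl

minusI : SL2Z
minusI = mat (ℤ.- + 1) (+ 0) (+ 0) (ℤ.- + 1) refl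

σ : SL2Z
σ = mat (+ 0) (ℤ.- + 1) (+ 1) (+ 0) refl

τ : SL2Z
τ = mat (+ 0) (ℤ.- + 1) (+ 1) (ℤ.- + 1) refl

ℤ→ℚ : ℤ → ℚ
ℤ→ℚ z = z ℚ./ 1

frac : ℚ → ℚ → P1
frac num den with den ℚP.≟ ℚ.0ℚ
... | yes _ = ∞
... | no den≢0 = fin (ℚ._÷_ num den {{ℚ.≢-nonZero den≢0}})

_⊙_ : SL2Z → P1 → P1
mat a b c d _ ⊙ fin x =
  frac (ℤ→ℚ a ℚ.* x ℚ.+ ℤ→ℚ b) (ℤ→ℚ c ℚ.* x ℚ.+ ℤ→ℚ d)
mat a b c d _ ⊙ ∞ = frac (ℤ→ℚ a) (ℤ→ℚ c)

record SL2ZAction {c ℓ : Level} (U : Group c ℓ) : Set (c ⊔ ℓ) where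
  open Group U
  field
    act       : SL2Z → Carrier → Carrier
    act-cong  : ∀ g {x y} → x ≈ y → act g x ≈ act g y
    act-hom   : ∀ g x y → act g (x ∙ y) ≈ act g x ∙ act g y
    act-id    : ∀ x → act I x ≈ x
    act-comp  : ∀ g h x → act (g · h) x ≈ act g (act h x)

module _ {c ℓ : Level} (U : Group c ℓ) (A : SL2ZAction U) where
  open Group U
  open SL2ZAction A

  InU₊ : Carrier → Set ℓ
  InU₊ u = act minusI u ≈ u

  -- U-valued pseudo-measure; J α β is the value on the segment with
  -- ingoing end α and outgoing end β
  record IsPseudoMeasure (J : P1 → P1 → Carrier) : Set ℓ where
    field
      refl-1  : ∀ α → J α α ≈ ε
      inv-1   : ∀ α β → J β α ∙ J α β ≈ ε
      cocycle : ∀ α β γ → J γ α ∙ J β γ ∙ J α β ≈ ε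

  IsModular : (P1 → P1 → Carrier) → Set ℓ
  IsModular J = ∀ g α β → J (g ⊙ α) (g ⊙ β) ≈ act g (J α β)

  IsModularPseudoMeasure : (P1 → P1 → Carrier) → Set ℓ
  IsModularPseudoMeasure J = IsPseudoMeasure J × IsModular J

  φ : Carrier → Carrier × Carrier
  φ u = (act σ u ∙ u , act (τ · τ) u ∙ act τ u ∙ u)

  InFiber : Carrier → Set ℓ
  InFiber u = InU₊ u × (act σ u ∙ u ≈ ε) × (act (τ · τ) u ∙ act τ u ∙ u ≈ ε)

  0P : P1
  0P = fin ℚ.0ℚ

  -- J ↦ J(∞,0) is a bijection M_U(SL(2,ℤ)) ≅ φ⁻¹(1,1), where M_U carries
  -- pointwise equality and U its group equality ≈.
  EvalIsBijection : Set (c ⊔ ℓ)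
  EvalIsBijection =
    (∀ J → IsModularPseudoMeasure J → InFiber (J ∞ 0P))
    × (∀ J J′ → IsModularPseudoMeasure J → IsModularPseudoMeasure J′ →
         J ∞ 0P ≈ J′ ∞ 0P → ∀ α β → J α β ≈ J′ α β)
    × (∀ u → InFiber u →
         Σ (P1 → P1 → Carrier) λ J → IsModularPseudoMeasure J × J ∞ 0P ≈ u)

{-# OPTIONS --safe #-}

-- Since σ∞ = 0, σ0 = ∞ and τ: ∞ ↦ 0 ↦ 1 ↦ ∞, modularity and the cocycle relation force
-- u = J(∞,0) into φ⁻¹(1,1) ∩ U₊.  They also turn the Euclidean algorithm
-- p/q = Tⁿ(r/q), r/q = σ(−q/r) into a recursion computing J(α,∞) from u alone, and
-- J(α,β) = J(β,∞)⁻¹ J(α,∞); so J is determined by u.  Conversely, for u in the fibre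
-- the same recursion defines G : P¹(ℚ) → U, and J(α,β) = G(β)⁻¹ G(α) is a pseudo-measure
-- which is modular as soon as G(gα) = G(g∞) · g[G(α)] for all g.  This relation is
-- stable under products, so it suffices to check it for the generators Tⁿ and σ of
-- SL(2,ℤ).  For Tⁿ it holds by construction; for σ it is proved by induction on
-- denominators, using σ² = −I (which fixes U₊) and τ = σT⁻¹ with τ³ = I (which is where
-- τ²[u] τ[u] u = 1 enters).

module Submission where

open import Level using (Level)
open import Algebra.Bundles using (Group)
open import Data.Product using (_,_)
open import Defs

module Division where
  open import Data.Nat as ℕ using (ℕ)
  open import Data.Integer as ℤ using (ℤ; +_; 1ℤ; _+_; _*_; _≤_; _<_; _/ℕ_; _%ℕ_)
  import Data.Integer.Properties as ℤP
  import Data.Integer.DivMod as ℤ÷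
  open import Data.Product using (_×_; _,_)
  open import Relation.Binary.PropositionalEquality
  open import Algebra.Bundles using (AbelianGroup)
  open import Algebra.Properties.Group (AbelianGroup.group ℤP.+-0-abelianGroup) using (∙-cancelʳ)

  quotient-≤ : ∀ q .{{_ : ℕ.NonZero q}} {n n′ r r′} → r′ ℕ.< q →
               + r + n * + q ≡ + r′ + n′ * + q → n ≤ n′
  quotient-≤ q {n} {n′} {r} {r′} r′<q eq = subst (n ≤_) (ℤP.pred-suc n′) (ℤP.i<j⇒i≤pred[j] n<1+n′)
    where
    open ℤP.≤-Reasoning
    n<1+n′ : n < ℤ.suc n′
    n<1+n′ = ℤP.*-cancelʳ-<-nonNeg (+ q) (begin-strict
      n * + q             ≤⟨ ℤP.i≤j+i (n * + q) (+ r) ⟩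
      + r + n * + q       ≡⟨ eq ⟩
      + r′ + n′ * + q     <⟨ ℤP.+-monoˡ-< (n′ * + q) (ℤ.+<+ r′<q) ⟩
      + q + n′ * + q      ≡⟨ cong (_+ n′ * + q) (ℤP.*-identityˡ (+ q)) ⟨
      1ℤ * + q + n′ * + q ≡⟨ ℤP.*-distribʳ-+ (+ q) 1ℤ n′ ⟨
      ℤ.suc n′ * + q       ∎)

  divmod-unique : ∀ p q .{{_ : ℕ.NonZero q}} {n r} → r ℕ.< q → p ≡ + r + n * + q →
                  p /ℕ q ≡ n × p %ℕ q ≡ r
  divmod-unique p q {n} {r} r<q p≡ = quotient≡ , ℤP.+-injective (∙-cancelʳ (n * + q) _ _ remainders)
    where
    p≡′ : p ≡ + (p %ℕ q) + (p /ℕ q) * + q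
    p≡′ = ℤ÷.a≡a%ℕn+[a/ℕn]*n p q
    quotient≡ : p /ℕ q ≡ n
    quotient≡ = ℤP.≤-antisym (quotient-≤ q r<q (trans (sym p≡′) p≡))
                             (quotient-≤ q (ℤ÷.n%ℕd<d p q) (trans (sym p≡) p≡′))
    remainders : + (p %ℕ q) + n * + q ≡ + r + n * + q
    remainders = trans (cong (λ k → + (p %ℕ q) + k * + q) (sym quotient≡)) (trans (sym p≡′) p≡)

module Coordinates where
  open import Data.Integer as ℤ using (ℤ; +_; 0ℤ; 1ℤ; _+_; _-_; _*_; -_)
  import Data.Integer.Properties as ℤP
  open import Data.Integer.Tactic.RingSolver using (solve-∀)
  open import Data.Integer.GCD using (gcd)
  open import Data.Rational as ℚ using (ℚ; ↥_; ↧_)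
  import Data.Rational.Properties as ℚP
  import Data.Rational.Unnormalised as ℚᵘ
  open import Data.Product using (_×_; _,_)
  open import Data.Sum using (inj₁; inj₂)
  open import Data.Empty using (⊥-elim)
  open import Relation.Nullary using (¬_; yes; no)
  open import Relation.Binary.PropositionalEquality
  open import Function using (_$_)

  open ≡-Reasoning

  ↧≢0 : ∀ x → ↧ x ≢ 0ℤ
  ↧≢0 x ()

  *-cancelʳ : ∀ {i j k} → k ≢ 0ℤ → i * k ≡ j * k → i ≡ j
  *-cancelʳ {i} {j} {k} k≢0 = ℤP.*-cancelʳ-≡ i j k {{ℤ.≢-nonZero k≢0}}

  *-≢0 : ∀ {i j} → i ≢ 0ℤ → j ≢ 0ℤ → i * j ≢ 0ℤ
  *-≢0 {i} i≢0 j≢0 ij≡0 with ℤP.i*j≡0⇒i≡0∨j≡0 i ij≡0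
  ... | inj₁ i≡0 = i≢0 i≡0
  ... | inj₂ j≡0 = j≢0 j≡0

  record IsRatio (x : ℚ) (n m : ℤ) : Set where
    constructor ratio
    field cross : ↥ x * m ≡ n * ↧ x

  ratio-self : ∀ x → IsRatio x (↥ x) (↧ x)
  ratio-self x = ratio refl

  -- The record patterns are needed for toℚᵘ to compute.
  toℚᵘ-homo-*′ : ∀ x y → ↥ (x ℚ.* y) * (↧ x * ↧ y) ≡ ↥ x * ↥ y * ↧ (x ℚ.* y)
  toℚᵘ-homo-*′ x@record{} y@record{} with x ℚ.* y | ℚP.toℚᵘ-homo-* x y
  ... | record{} | ℚᵘ.*≡* eq = eq

  toℚᵘ-homo-+′ : ∀ x y → ↥ (x ℚ.+ y) * (↧ x * ↧ y) ≡ (↥ x * ↧ y + ↥ y * ↧ x) * ↧ (x ℚ.+ y)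
  toℚᵘ-homo-+′ x@record{} y@record{} with x ℚ.+ y | ℚP.toℚᵘ-homo-+ x y
  ... | record{} | ℚᵘ.*≡* eq = eq

  ratio-* : ∀ {x y n m n′ m′} → IsRatio x n m → IsRatio y n′ m′ → IsRatio (x ℚ.* y) (n * n′) (m * m′)
  ratio-* {x} {y} {n} {m} {n′} {m′} (ratio fx) (ratio fy) = ratio $ *-cancelʳ (*-≢0 (↧≢0 x) (↧≢0 y)) (begin
    ↥ z * (m * m′) * (↧ x * ↧ y)    ≡⟨ regroup₁ (↥ z) (↧ x) (↧ y) m m′ ⟩
    ↥ z * (↧ x * ↧ y) * (m * m′)    ≡⟨ cong (_* (m * m′)) (toℚᵘ-homo-*′ x y) ⟩
    ↥ x * ↥ y * ↧ z * (m * m′)      ≡⟨ regroup₂ (↥ x) (↥ y) (↧ z) m m′ ⟩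
    (↥ x * m) * (↥ y * m′) * ↧ z    ≡⟨ cong (_* ↧ z) (cong₂ _*_ fx fy) ⟩
    (n * ↧ x) * (n′ * ↧ y) * ↧ z    ≡⟨ regroup₃ n n′ (↧ x) (↧ y) (↧ z) ⟩
    n * n′ * ↧ z * (↧ x * ↧ y)      ∎)
    where
    z : ℚ
    z = x ℚ.* y
    regroup₁ : ∀ a b c m m′ → a * (m * m′) * (b * c) ≡ a * (b * c) * (m * m′)
    regroup₁ = solve-∀
    regroup₂ : ∀ a b c m m′ → a * b * c * (m * m′) ≡ (a * m) * (b * m′) * c
    regroup₂ = solve-∀
    regroup₃ : ∀ n n′ a b c → (n * a) * (n′ * b) * c ≡ n * n′ * c * (a * b)
    regroup₃ = solve-∀

  ratio-+ : ∀ {x y n m n′ m′} → IsRatio x n m → IsRatio y n′ m′ →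
            IsRatio (x ℚ.+ y) (n * m′ + n′ * m) (m * m′)
  ratio-+ {x} {y} {n} {m} {n′} {m′} (ratio fx) (ratio fy) = ratio $ *-cancelʳ (*-≢0 (↧≢0 x) (↧≢0 y)) (begin
    ↥ z * (m * m′) * (↧ x * ↧ y)                              ≡⟨ regroup₁ (↥ z) (↧ x) (↧ y) m m′ ⟩
    ↥ z * (↧ x * ↧ y) * (m * m′)                              ≡⟨ cong (_* (m * m′)) (toℚᵘ-homo-+′ x y) ⟩
    (↥ x * ↧ y + ↥ y * ↧ x) * ↧ z * (m * m′)                  ≡⟨ regroup₂ (↥ x) (↥ y) (↧ x) (↧ y) (↧ z) m m′ ⟩
    (↥ x * m) * ↧ y * m′ * ↧ z + (↥ y * m′) * ↧ x * m * ↧ z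
      ≡⟨ cong₂ _+_ (cong (λ t → t * ↧ y * m′ * ↧ z) fx) (cong (λ t → t * ↧ x * m * ↧ z) fy) ⟩
    (n * ↧ x) * ↧ y * m′ * ↧ z + (n′ * ↧ y) * ↧ x * m * ↧ z   ≡⟨ regroup₃ n n′ (↧ x) (↧ y) (↧ z) m m′ ⟩
    (n * m′ + n′ * m) * ↧ z * (↧ x * ↧ y)                     ∎)
    where
    z : ℚ
    z = x ℚ.+ y
    regroup₁ : ∀ a b c m m′ → a * (m * m′) * (b * c) ≡ a * (b * c) * (m * m′)
    regroup₁ = solve-∀
    regroup₂ : ∀ a b c d e m m′ → (a * d + b * c) * e * (m * m′) ≡ (a * m) * d * m′ * e + (b * m′) * c * m * e
    regroup₂ = solve-∀
    regroup₃ : ∀ n n′ c d e m m′ → (n * c) * d * m′ * e + (n′ * d) * c * m * e ≡ (n * m′ + n′ * m) * e * (c * d)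
    regroup₃ = solve-∀

  ratio-ℤ : ∀ k → IsRatio (ℤ→ℚ k) k 1ℤ
  ratio-ℤ k = ratio $ begin
    ↥ x * 1ℤ        ≡⟨ cong (↥ x *_) (ℚP.↧-/ k 1) ⟨
    ↥ x * (↧ x * g) ≡⟨ regroup (↥ x) (↧ x) g ⟩
    (↥ x * g) * ↧ x ≡⟨ cong (_* ↧ x) (ℚP.↥-/ k 1) ⟩
    k * ↧ x         ∎
    where
    x : ℚ
    x = ℤ→ℚ k
    g : ℤ
    g = gcd k 1ℤ
    regroup : ∀ a b g → a * (b * g) ≡ (a * g) * b
    regroup = solve-∀

  ratio-cross : ∀ {x n m n′ m′} → IsRatio x n m → IsRatio x n′ m′ → n * m′ ≡ n′ * m
  ratio-cross {x} {n} {m} {n′} {m′} (ratio f) (ratio f′) = *-cancelʳ (↧≢0 x) (begin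
    n * m′ * ↧ x   ≡⟨ regroup n m′ (↧ x) ⟩
    n * ↧ x * m′   ≡⟨ cong (_* m′) f ⟨
    ↥ x * m * m′   ≡⟨ regroup (↥ x) m m′ ⟩
    ↥ x * m′ * m   ≡⟨ cong (_* m) f′ ⟩
    n′ * ↧ x * m   ≡⟨ regroup n′ (↧ x) m ⟩
    n′ * m * ↧ x   ∎)
    where
    regroup : ∀ a b c → a * b * c ≡ a * c * b
    regroup = solve-∀

  ℤ² : Set
  ℤ² = ℤ × ℤ

  NonZero² : ℤ² → Set
  NonZero² (p , q) = ¬ (p ≡ 0ℤ × q ≡ 0ℤ)

  Coords : P1 → ℤ² → Set
  Coords (fin x) (p , q) = q ≢ 0ℤ × IsRatio x p q
  Coords ∞       (p , q) = q ≡ 0ℤ × p ≢ 0ℤ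

  coords : P1 → ℤ²
  coords (fin x) = ↥ x , ↧ x
  coords ∞       = 1ℤ , 0ℤ

  coords-Coords : ∀ α → Coords α (coords α)
  coords-Coords (fin x) = ↧≢0 x , ratio-self x
  coords-Coords ∞       = refl , λ ()

  Coords⇒NonZero² : ∀ α {v} → Coords α v → NonZero² v
  Coords⇒NonZero² (fin x) (q≢0 , _) (_ , q≡0) = q≢0 q≡0
  Coords⇒NonZero² ∞       (_ , p≢0) (p≡0 , _) = p≢0 p≡0

  Coords-unique : ∀ α β {p q p′ q′} → Coords α (p , q) → Coords β (p′ , q′) →
                  p * q′ ≡ p′ * q → α ≡ β
  Coords-unique (fin x) (fin y) {p} {q} {p′} {q′} (q≢0 , ratio fx) (q′≢0 , ratio fy) pq′≡p′q =
    cong fin (ℚP.≃⇒≡ (ℚ.*≡* (*-cancelʳ (*-≢0 q≢0 q′≢0) (begin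
      ↥ x * ↧ y * (q * q′)    ≡⟨ regroup₁ (↥ x) (↧ y) q q′ ⟩
      ↥ x * q * ↧ y * q′      ≡⟨ cong (λ t → t * ↧ y * q′) fx ⟩
      p * ↧ x * ↧ y * q′      ≡⟨ regroup₂ p (↧ x) (↧ y) q′ ⟩
      p * q′ * ↧ x * ↧ y      ≡⟨ cong (λ t → t * ↧ x * ↧ y) pq′≡p′q ⟩
      p′ * q * ↧ x * ↧ y      ≡⟨ regroup₄ p′ (↧ y) (↧ x) q ⟨
      p′ * ↧ y * ↧ x * q      ≡⟨ cong (λ t → t * ↧ x * q) fy ⟨
      ↥ y * q′ * ↧ x * q      ≡⟨ regroup₃ (↥ y) (↧ x) q q′ ⟩
      ↥ y * ↧ x * (q * q′)    ∎))))
    where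
    regroup₁ : ∀ a b q q′ → a * b * (q * q′) ≡ a * q * b * q′
    regroup₁ = solve-∀
    regroup₂ : ∀ p a b q′ → p * a * b * q′ ≡ p * q′ * a * b
    regroup₂ = solve-∀
    regroup₃ : ∀ a b q q′ → a * q′ * b * q ≡ a * b * (q * q′)
    regroup₃ = solve-∀
    regroup₄ : ∀ p a b q → p * a * b * q ≡ p * q * b * a
    regroup₄ = solve-∀
  Coords-unique (fin x) ∞ {p} (q≢0 , _) (q′≡0 , p′≢0) pq′≡p′q
    with ℤP.i*j≡0⇒i≡0∨j≡0 _ (trans (sym pq′≡p′q) (trans (cong (p *_) q′≡0) (ℤP.*-zeroʳ p)))
  ... | inj₁ p′≡0 = ⊥-elim (p′≢0 p′≡0)
  ... | inj₂ q≡0  = ⊥-elim (q≢0 q≡0)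
  Coords-unique ∞ (fin y) {p} {q} {p′} (q≡0 , p≢0) (q′≢0 , _) pq′≡p′q
    with ℤP.i*j≡0⇒i≡0∨j≡0 p (trans pq′≡p′q (trans (cong (p′ *_) q≡0) (ℤP.*-zeroʳ p′)))
  ... | inj₁ p≡0  = ⊥-elim (p≢0 p≡0)
  ... | inj₂ q′≡0 = ⊥-elim (q′≢0 q′≡0)
  Coords-unique ∞ ∞ _ _ _ = refl

  ratio-scale : ∀ {x n m} k → IsRatio x n m → IsRatio x (n * k) (m * k)
  ratio-scale {x} {n} {m} k (ratio f) = ratio $ begin
    ↥ x * (m * k)  ≡⟨ ℤP.*-assoc (↥ x) m k ⟨
    ↥ x * m * k    ≡⟨ cong (_* k) f ⟩
    n * ↧ x * k    ≡⟨ regroup n (↧ x) k ⟩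
    n * k * ↧ x    ∎
    where
    regroup : ∀ a b c → a * b * c ≡ a * c * b
    regroup = solve-∀

  frac-Coords : ∀ x y {n d s} → s ≢ 0ℤ → NonZero² (n , d) →
                IsRatio x n s → IsRatio y d s → Coords (frac x y) (n , d)
  frac-Coords x y {n} {d} {s} s≢0 nd≢0 fx fy@(ratio y-cross) with y ℚP.≟ ℚ.0ℚ
  ... | yes refl = d≡0 , λ n≡0 → nd≢0 (n≡0 , d≡0)
    where
    d≡0 : d ≡ 0ℤ
    d≡0 = trans (sym (ℤP.*-identityʳ d)) (sym y-cross)
  ... | no y≢0 = d≢0 , ratio-÷
    where
    instance
      y-nonZero : ℚ.NonZero y
      y-nonZero = ℚ.≢-nonZero y≢0
    d≢0 : d ≢ 0ℤ
    d≢0 refl with ℤP.i*j≡0⇒i≡0∨j≡0 (↥ y) y-cross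
    ... | inj₁ ↥y≡0 = y≢0 (ℚP.↥p≡0⇒p≡0 y ↥y≡0)
    ... | inj₂ s≡0  = s≢0 s≡0
    z : ℚ
    z = x ℚ.÷ y
    z*y≡x : z ℚ.* y ≡ x
    z*y≡x = begin
      x ℚ.* ℚ.1/ y ℚ.* y    ≡⟨ ℚP.*-assoc x (ℚ.1/ y) y ⟩
      x ℚ.* (ℚ.1/ y ℚ.* y)  ≡⟨ cong (x ℚ.*_) (ℚP.*-inverseˡ y) ⟩
      x ℚ.* ℚ.1ℚ            ≡⟨ ℚP.*-identityʳ x ⟩
      x                     ∎
    x-ratio : IsRatio x (↥ z * d) (↧ z * s)
    x-ratio = subst (λ t → IsRatio t (↥ z * d) (↧ z * s)) z*y≡x (ratio-* (ratio-self z) fy)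
    ratio-÷ : IsRatio z n d
    ratio-÷ = ratio $ *-cancelʳ s≢0 (begin
      ↥ z * d * s      ≡⟨ ratio-cross x-ratio fx ⟩
      n * (↧ z * s)    ≡⟨ ℤP.*-assoc n (↧ z) s ⟨
      n * ↧ z * s      ∎)

  _⊛_ : SL2Z → ℤ² → ℤ²
  mat a b c d _ ⊛ (p , q) = a * p + b * q , c * p + d * q

  ·-⊛ : ∀ g h v → (g · h) ⊛ v ≡ g ⊛ (h ⊛ v)
  ·-⊛ (mat a b c d _) (mat a′ b′ c′ d′ _) (p , q) =
    cong₂ _,_ (expand a b a′ b′ c′ d′ p q) (expand c d a′ b′ c′ d′ p q)
    where
    expand : ∀ a b a′ b′ c′ d′ p q →
             (a * a′ + b * c′) * p + (a * b′ + b * d′) * q ≡ a * (a′ * p + b′ * q) + b * (c′ * p + d′ * q)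
    expand = solve-∀

  ⊛-NonZero² : ∀ g {v} → NonZero² v → NonZero² (g ⊛ v)
  ⊛-NonZero² (mat a b c d det) {p , q} v≢0 (N≡0 , D≡0) =
    v≢0 (vanish p d b (cramer₁ a b c d p q) , vanish q (- c) (- a) (cramer₂ a b c d p q))
    where
    N D : ℤ
    N = a * p + b * q
    D = c * p + d * q
    vanish : ∀ t x y → (a * d - b * c) * t ≡ x * N - y * D → t ≡ 0ℤ
    vanish t x y eq = begin
      t                     ≡⟨ ℤP.*-identityˡ t ⟨
      1ℤ * t                ≡⟨ cong (_* t) det ⟨
      (a * d - b * c) * t   ≡⟨ eq ⟩
      x * N - y * D         ≡⟨ cong₂ (λ N D → x * N - y * D) N≡0 D≡0 ⟩
      x * 0ℤ - y * 0ℤ       ≡⟨ cong₂ _-_ (ℤP.*-zeroʳ x) (ℤP.*-zeroʳ y) ⟩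
      0ℤ                    ∎
    cramer₁ : ∀ a b c d p q → (a * d - b * c) * p ≡ d * (a * p + b * q) - b * (c * p + d * q)
    cramer₁ = solve-∀
    cramer₂ : ∀ a b c d p q → (a * d - b * c) * q ≡ (- c) * (a * p + b * q) - (- a) * (c * p + d * q)
    cramer₂ = solve-∀

  ⊙-Coords : ∀ g α {v} → Coords α v → Coords (g ⊙ α) (g ⊛ v)
  ⊙-Coords g@(mat a b c d _) (fin x) {p , q} v@(q≢0 , fx) =
    frac-Coords _ _ q≢0 (⊛-NonZero² g (Coords⇒NonZero² (fin x) v)) (affine a b) (affine c d)
    where
    affine : ∀ a b → IsRatio (ℤ→ℚ a ℚ.* x ℚ.+ ℤ→ℚ b) (a * p + b * q) q
    affine a b = subst₂ (IsRatio (ℤ→ℚ a ℚ.* x ℚ.+ ℤ→ℚ b)) (tidy₁ a p b q) (tidy₂ q)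
                        (ratio-+ (ratio-* (ratio-ℤ a) fx) (ratio-ℤ b))
      where
      tidy₁ : ∀ a p b q → a * p * 1ℤ + b * (1ℤ * q) ≡ a * p + b * q
      tidy₁ = solve-∀
      tidy₂ : ∀ q → 1ℤ * q * 1ℤ ≡ q
      tidy₂ = solve-∀
  ⊙-Coords g@(mat a b c d _) ∞ {p , q} v@(refl , p≢0) =
    frac-Coords _ _ p≢0 (⊛-NonZero² g (Coords⇒NonZero² ∞ v)) (column a b) (column c d)
    where
    column : ∀ a b → IsRatio (ℤ→ℚ a) (a * p + b * 0ℤ) p
    column a b = subst₂ (IsRatio (ℤ→ℚ a)) (tidy a b p) (ℤP.*-identityˡ p) (ratio-scale p (ratio-ℤ a))
      where
      tidy : ∀ a b p → a * p ≡ a * p + b * 0ℤ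
      tidy = solve-∀

  frac-ℤ-Coords : ∀ a b → b ≢ 0ℤ → Coords (frac (ℤ→ℚ a) (ℤ→ℚ b)) (a , b)
  frac-ℤ-Coords a b b≢0 = frac-Coords _ _ (λ ()) (λ (_ , b≡0) → b≢0 b≡0) (ratio-ℤ a) (ratio-ℤ b)

module Matrices where
  open import Data.Nat as ℕ using (ℕ)
  import Data.Nat.Properties as ℕP
  open import Data.Nat.Induction using (<-rec)
  open import Data.Integer as ℤ using (ℤ; +_; -[1+_]; +[1+_]; 0ℤ; 1ℤ; -1ℤ; _+_; _-_; _*_; -_; ∣_∣)
  import Data.Integer.Properties as ℤP
  import Data.Integer.DivMod as ℤ÷
  open import Data.Integer.Tactic.RingSolver using (solve-∀)
  open import Data.Product using (Σ-syntax; _×_; _,_)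
  open import Data.Sum using (_⊎_; inj₁; inj₂)
  open import Relation.Binary.PropositionalEquality using (_≡_; _≢_; refl; sym; trans; cong; subst)
  open import Axiom.UniquenessOfIdentityProofs.WithK using (uip)

  mat-≡ : ∀ {a b c d a′ b′ c′ d′ det det′} → a ≡ a′ → b ≡ b′ → c ≡ c′ → d ≡ d′ →
          mat a b c d det ≡ mat a′ b′ c′ d′ det′
  mat-≡ {det = det} {det′} refl refl refl refl = cong (mat _ _ _ _) (uip det det′)

  infix 30 T^_
  T^_ : ℤ → SL2Z
  T^ n = mat 1ℤ n 0ℤ 1ℤ (unipotent n)
    where
    unipotent : ∀ n → 1ℤ * 1ℤ - n * 0ℤ ≡ 1ℤ
    unipotent = solve-∀

  T^-+ : ∀ n k → T^ (n + k) ≡ T^ n · T^ k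
  T^-+ n k = mat-≡ (ea n) (eb n k) refl (ed n)
    where
    ea : ∀ n → 1ℤ ≡ 1ℤ * 1ℤ + n * 0ℤ
    ea = solve-∀
    eb : ∀ n k → n + k ≡ 1ℤ * k + n * 1ℤ
    eb = solve-∀
    ed : ∀ k → 1ℤ ≡ 0ℤ * k + 1ℤ * 1ℤ
    ed = solve-∀

  T^0≡I : T^ 0ℤ ≡ I
  T^0≡I = mat-≡ refl refl refl refl

  σ·σ≡minusI : σ · σ ≡ minusI
  σ·σ≡minusI = mat-≡ refl refl refl refl

  σ·T⁻¹≡τ : σ · T^ -1ℤ ≡ τ
  σ·T⁻¹≡τ = mat-≡ refl refl refl refl

  τ³≡I : (τ · τ) · τ ≡ I
  τ³≡I = mat-≡ refl refl refl refl

  minusI-central : ∀ g → minusI · g ≡ g · minusI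
  minusI-central (mat a b c d _) = mat-≡ (ea a b c d) (eb a b c d) (ec a b c d) (ed a b c d)
    where
    ea : ∀ a b c d → -1ℤ * a + 0ℤ * c ≡ a * -1ℤ + b * 0ℤ
    ea = solve-∀
    eb : ∀ a b c d → -1ℤ * b + 0ℤ * d ≡ a * 0ℤ + b * -1ℤ
    eb = solve-∀
    ec : ∀ a b c d → 0ℤ * a + -1ℤ * c ≡ c * -1ℤ + d * 0ℤ
    ec = solve-∀
    ed : ∀ a b c d → 0ℤ * b + -1ℤ * d ≡ c * 0ℤ + d * -1ℤ
    ed = solve-∀

  units : ∀ a d → a * d ≡ 1ℤ → (a ≡ 1ℤ × d ≡ 1ℤ) ⊎ (a ≡ -1ℤ × d ≡ -1ℤ)
  units a d ad≡1 =
    signs (ℕP.m*n≡1⇒m≡1 ∣ a ∣ ∣ d ∣ ∣a∣∣d∣≡1) (ℕP.m*n≡1⇒n≡1 ∣ a ∣ ∣ d ∣ ∣a∣∣d∣≡1) ad≡1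
    where
    ∣a∣∣d∣≡1 : ∣ a ∣ ℕ.* ∣ d ∣ ≡ 1
    ∣a∣∣d∣≡1 = trans (sym (ℤP.abs-* a d)) (cong ∣_∣ ad≡1)
    signs : ∀ {a d} → ∣ a ∣ ≡ 1 → ∣ d ∣ ≡ 1 → a * d ≡ 1ℤ →
            (a ≡ 1ℤ × d ≡ 1ℤ) ⊎ (a ≡ -1ℤ × d ≡ -1ℤ)
    signs { +[1+ 0 ] } { +[1+ 0 ] } _ _ _  = inj₁ (refl , refl)
    signs { -[1+ 0 ] } { -[1+ 0 ] } _ _ _  = inj₂ (refl , refl)
    signs { +[1+ 0 ] } { -[1+ 0 ] } _ _ ()
    signs { -[1+ 0 ] } { +[1+ 0 ] } _ _ ()
    signs { + 0 }                     ()
    signs { +[1+ ℕ.suc _ ] }          ()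
    signs { -[1+ ℕ.suc _ ] }          ()
    signs {d = + 0}                 _ ()
    signs {d = +[1+ ℕ.suc _ ]}      _ ()
    signs {d = -[1+ ℕ.suc _ ]}      _ ()

  upper-triangular : ∀ {a b d} det →
    mat a b 0ℤ d det ≡ T^ b · I ⊎ mat a b 0ℤ d det ≡ σ · (σ · (T^ (- b) · I))
  upper-triangular {a} {b} {d} det = cases (units a d (trans (sym (ad-b0 a b d)) det)) det
    where
    ad-b0 : ∀ a b d → a * d - b * 0ℤ ≡ a * d
    ad-b0 = solve-∀
    cases : ∀ {a d} → (a ≡ 1ℤ × d ≡ 1ℤ) ⊎ (a ≡ -1ℤ × d ≡ -1ℤ) → ∀ det →
            mat a b 0ℤ d det ≡ T^ b · I ⊎ mat a b 0ℤ d det ≡ σ · (σ · (T^ (- b) · I))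
    cases (inj₁ (refl , refl)) _ = inj₁ (mat-≡ (ea b) (eb b) refl refl)
      where
      ea : ∀ b → 1ℤ ≡ 1ℤ * 1ℤ + b * 0ℤ
      ea = solve-∀
      eb : ∀ b → b ≡ 1ℤ * 0ℤ + b * 1ℤ
      eb = solve-∀
    cases (inj₂ (refl , refl)) _ = inj₂ (mat-≡ (ea b) (eb b) (ec b) (ed b))
      where
      ea : ∀ b → -1ℤ ≡ 0ℤ * (0ℤ * (1ℤ * 1ℤ + - b * 0ℤ) + -1ℤ * (0ℤ * 1ℤ + 1ℤ * 0ℤ))
                     + -1ℤ * (1ℤ * (1ℤ * 1ℤ + - b * 0ℤ) + 0ℤ * (0ℤ * 1ℤ + 1ℤ * 0ℤ))
      ea = solve-∀
      eb : ∀ b → b ≡ 0ℤ * (0ℤ * (1ℤ * 0ℤ + - b * 1ℤ) + -1ℤ * (0ℤ * 0ℤ + 1ℤ * 1ℤ))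
                    + -1ℤ * (1ℤ * (1ℤ * 0ℤ + - b * 1ℤ) + 0ℤ * (0ℤ * 0ℤ + 1ℤ * 1ℤ))
      eb = solve-∀
      ec : ∀ b → 0ℤ ≡ 1ℤ * (0ℤ * (1ℤ * 1ℤ + - b * 0ℤ) + -1ℤ * (0ℤ * 1ℤ + 1ℤ * 0ℤ))
                    + 0ℤ * (1ℤ * (1ℤ * 1ℤ + - b * 0ℤ) + 0ℤ * (0ℤ * 1ℤ + 1ℤ * 0ℤ))
      ec = solve-∀
      ed : ∀ b → -1ℤ ≡ 1ℤ * (0ℤ * (1ℤ * 0ℤ + - b * 1ℤ) + -1ℤ * (0ℤ * 0ℤ + 1ℤ * 1ℤ))
                     + 0ℤ * (1ℤ * (1ℤ * 0ℤ + - b * 1ℤ) + 0ℤ * (0ℤ * 0ℤ + 1ℤ * 1ℤ))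
      ed = solve-∀

  euclid-step : ∀ g → SL2Z.c g ≢ 0ℤ →
                Σ[ k ∈ ℤ ] Σ[ g′ ∈ SL2Z ] g ≡ T^ k · (σ · g′) × ∣ SL2Z.c g′ ∣ ℕ.< ∣ SL2Z.c g ∣
  euclid-step (mat a b c d det) c≢0 =
    k , mat c d (- r) (- s) (trans (det′ a b c d k) det) , mat-≡ (top a c k) (top b d k) (bottom a c k) (bottom b d k) , r<c
    where
    instance
      c-nonZero : ℤ.NonZero c
      c-nonZero = ℤ.≢-nonZero c≢0
    k r s : ℤ
    k = a ℤ./ c
    r = a - k * c
    s = b - k * d
    det′ : ∀ a b c d k → c * (- (b - k * d)) - d * (- (a - k * c)) ≡ a * d - b * c
    det′ = solve-∀
    top : ∀ a c k → a ≡ 1ℤ * (0ℤ * c + -1ℤ * (- (a - k * c))) + k * (1ℤ * c + 0ℤ * (- (a - k * c)))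
    top = solve-∀
    bottom : ∀ a c k → c ≡ 0ℤ * (0ℤ * c + -1ℤ * (- (a - k * c))) + 1ℤ * (1ℤ * c + 0ℤ * (- (a - k * c)))
    bottom = solve-∀
    r≡a%c : r ≡ + (a ℤ.% c)
    r≡a%c = trans (cong (_- k * c) (ℤ÷.a≡a%n+[a/n]*n a c)) (cancel (+ (a ℤ.% c)) (k * c))
      where
      cancel : ∀ x y → x + y - y ≡ x
      cancel = solve-∀
    r<c : ∣ - r ∣ ℕ.< ∣ c ∣
    r<c = subst (ℕ._< ∣ c ∣) (sym (trans (ℤP.∣-i∣≡∣i∣ r) (cong ∣_∣ r≡a%c))) (ℤ÷.n%d<d a c)


  module _ {p} (P : SL2Z → Set p) (P-I : P I)
           (P-T^ : ∀ n g → P g → P (T^ n · g)) (P-σ : ∀ g → P g → P (σ · g)) where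

    private
      Q : ℕ → Set p
      Q n = ∀ g → ∣ SL2Z.c g ∣ ≡ n → P g

      descend : ∀ g → SL2Z.c g ≢ 0ℤ → (∀ {g′} → ∣ SL2Z.c g′ ∣ ℕ.< ∣ SL2Z.c g ∣ → P g′) → P g
      descend g c≢0 ih = from-step (euclid-step g c≢0)
        where
        from-step : Σ[ k ∈ ℤ ] Σ[ g′ ∈ SL2Z ] g ≡ T^ k · (σ · g′) × ∣ SL2Z.c g′ ∣ ℕ.< ∣ SL2Z.c g ∣ → P g
        from-step (k , g′ , g≡T^kσg′ , smaller) = subst P (sym g≡T^kσg′) (P-T^ k (σ · g′) (P-σ g′ (ih smaller)))

      step : ∀ n → (∀ {m} → m ℕ.< n → Q m) → Q n
      step _ _ (mat a b (+ 0) d det) _ = from-cases (upper-triangular det)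
        where
        from-cases : mat a b 0ℤ d det ≡ T^ b · I ⊎ mat a b 0ℤ d det ≡ σ · (σ · (T^ (- b) · I)) → P (mat a b 0ℤ d det)
        from-cases (inj₁ g≡T^b)    = subst P (sym g≡T^b) (P-T^ b I P-I)
        from-cases (inj₂ g≡σσT^-b) =
          subst P (sym g≡σσT^-b) (P-σ (σ · (T^ (- b) · I)) (P-σ (T^ (- b) · I) (P-T^ (- b) I P-I)))
      step _ rec g@(mat _ _ +[1+ _ ] _ _) refl = descend g (λ ()) (λ {g′} smaller → rec smaller g′ refl)
      step _ rec g@(mat _ _ -[1+ _ ] _ _) refl = descend g (λ ()) (λ {g′} smaller → rec smaller g′ refl)

    SL2Z-generated : ∀ g → P g
    SL2Z-generated g = <-rec Q step _ g refl

module ModularPseudoMeasures where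
  open import Data.Nat as ℕ using (ℕ; zero; suc; z≤n; s≤s)
  import Data.Nat.Properties as ℕP
  open import Data.Nat.Induction using (<-rec)
  open import Data.Integer as ℤ using (ℤ; +_; -[1+_]; +[1+_]; 0ℤ; 1ℤ; -1ℤ; _+_; _-_; _*_; -_; _/ℕ_; _%ℕ_)
  import Data.Integer.Properties as ℤP
  import Data.Integer.DivMod as ℤ÷
  open import Data.Integer.Tactic.RingSolver using (solve-∀)
  open import Data.Rational as ℚ using (↥_; ↧_)
  open import Data.Product using (Σ; _×_; _,_; proj₁; proj₂)
  open import Data.Empty using (⊥-elim)
  open import Relation.Nullary using (yes; no)
  open import Relation.Binary.PropositionalEquality as ≡ using (_≡_; _≢_; cong; cong₂; subst)
  open Division
  open Coordinates
  open Matrices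

  module _ {c ℓ : Level} (U : Group c ℓ) (A : SL2ZAction U) where
    open Group U hiding (_-_)
    open SL2ZAction A
    open import Algebra.Properties.Group U
    open import Relation.Binary.Reasoning.Setoid setoid

    act-≡ : ∀ {g h} x → g ≡ h → act g x ≈ act h x
    act-≡ x ≡.refl = refl

    act-ε : ∀ g → act g ε ≈ ε
    act-ε g = identityˡ-unique (act g ε) (act g ε) (trans (sym (act-hom g ε ε)) (act-cong g (identityˡ ε)))

    act-⁻¹ : ∀ g x → act g (x ⁻¹) ≈ act g x ⁻¹
    act-⁻¹ g x = inverseˡ-unique (act g (x ⁻¹)) (act g x)
      (trans (sym (act-hom g (x ⁻¹) x)) (trans (act-cong g (inverseˡ x)) (act-ε g)))

    act-\\ : ∀ g x y → act g (x \\ y) ≈ act g x \\ act g y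
    act-\\ g x y = trans (act-hom g (x ⁻¹) y) (∙-congʳ (act-⁻¹ g x))

    act-minusI-comm : ∀ g x → act minusI (act g x) ≈ act g (act minusI x)
    act-minusI-comm g x = begin
      act minusI (act g x)  ≈⟨ act-comp minusI g x ⟨
      act (minusI · g) x    ≈⟨ act-≡ x (minusI-central g) ⟩
      act (g · minusI) x    ≈⟨ act-comp g minusI x ⟩
      act g (act minusI x)  ∎

    \\-chain : ∀ x y z → (x \\ y) ∙ (y \\ z) ≈ x \\ z
    \\-chain x y z = begin
      (x ⁻¹ ∙ y) ∙ (y ⁻¹ ∙ z)  ≈⟨ assoc (x ⁻¹) y (y ⁻¹ ∙ z) ⟩
      x ⁻¹ ∙ (y ∙ (y \\ z))    ≈⟨ ∙-congˡ (\\-leftDividesˡ y z) ⟩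
      x ⁻¹ ∙ z                 ∎

    \\-cancelˡ : ∀ k x y → (k ∙ x) \\ (k ∙ y) ≈ x \\ y
    \\-cancelˡ k x y = begin
      (k ∙ x) ⁻¹ ∙ (k ∙ y)        ≈⟨ ∙-congʳ (⁻¹-anti-homo-∙ k x) ⟩
      (x ⁻¹ ∙ k ⁻¹) ∙ (k ∙ y)     ≈⟨ assoc (x ⁻¹) (k ⁻¹) (k ∙ y) ⟩
      x ⁻¹ ∙ (k \\ (k ∙ y))       ≈⟨ ∙-congˡ (\\-leftDividesʳ k y) ⟩
      x ⁻¹ ∙ y                    ∎

    coboundary-isPseudoMeasure : (G : P1 → Carrier) → IsPseudoMeasure U A (λ α β → G β \\ G α)
    coboundary-isPseudoMeasure G = record
      { refl-1  = λ α → inverseˡ (G α)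
      ; inv-1   = λ α β → trans (\\-chain (G α) (G β) (G α)) (inverseˡ (G α))
      ; cocycle = λ α β γ → trans (∙-congʳ (\\-chain (G α) (G γ) (G β)))
                                  (trans (\\-chain (G α) (G β) (G α)) (inverseˡ (G α)))
      }

    module PseudoMeasure {J : P1 → P1 → Carrier} (pm : IsPseudoMeasure U A J) where
      open IsPseudoMeasure pm

      J-flip : ∀ α β → J β α ≈ J α β ⁻¹
      J-flip α β = inverseˡ-unique (J β α) (J α β) (inv-1 α β)

      J-via : ∀ α β γ → J α β ≈ J β γ \\ J α γ
      J-via α β γ = begin
        J α β                     ≈⟨ inverseʳ-unique (J γ α ∙ J β γ) (J α β) (cocycle α β γ) ⟩
        (J γ α ∙ J β γ) ⁻¹        ≈⟨ ⁻¹-anti-homo-∙ (J γ α) (J β γ) ⟩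
        J β γ ⁻¹ ∙ J γ α ⁻¹       ≈⟨ ∙-congˡ (⁻¹-cong (J-flip α γ)) ⟩
        J β γ ⁻¹ ∙ J α γ ⁻¹ ⁻¹    ≈⟨ ∙-congˡ (⁻¹-involutive (J α γ)) ⟩
        J β γ \\ J α γ            ∎

    J∞0-inFiber : ∀ J → IsModularPseudoMeasure U A J → InFiber U A (J ∞ (0P U A))
    J∞0-inFiber J (pm , modular) = fixed-by-minusI , σ-relation , τ-relation
      where
      open IsPseudoMeasure pm
      fixed-by-minusI : act minusI (J ∞ (0P U A)) ≈ J ∞ (0P U A)
      fixed-by-minusI = sym (modular minusI ∞ (0P U A))
      σ-relation : act σ (J ∞ (0P U A)) ∙ J ∞ (0P U A) ≈ ε
      σ-relation = trans (∙-congʳ (sym (modular σ ∞ (0P U A)))) (inv-1 ∞ (0P U A))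
      τ-relation : act (τ · τ) (J ∞ (0P U A)) ∙ act τ (J ∞ (0P U A)) ∙ J ∞ (0P U A) ≈ ε
      τ-relation = trans (∙-congʳ (∙-cong (sym (modular (τ · τ) ∞ (0P U A))) (sym (modular τ ∞ (0P U A)))))
                         (cocycle ∞ (0P U A) (fin ℚ.1ℚ))

    module Euclid (w : Carrier) where

      -- G-fuel k p m computes J(p/(m+1), ∞) for the modular pseudo-measure J with
      -- J(0,∞) = w by the Euclidean algorithm p/(m+1) = Tⁿ(r/(m+1)), r/(m+1) = σ(−(m+1)/r);
      -- denominators decrease, so fuel k > m suffices.
      mutual
        G-fuel : ℕ → ℤ → ℕ → Carrier
        G-fuel zero    _ _ = ε
        G-fuel (suc k) p m = act (T^ (p /ℕ suc m)) (H-fuel k m (p %ℕ suc m))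

        H-fuel : ℕ → ℕ → ℕ → Carrier
        H-fuel _ _ zero    = w
        H-fuel k m (suc r) = w ∙ act σ (G-fuel k -[1+ m ] r)

      mutual
        G-fuel-enough : ∀ {k k′} p m → m ℕ.< k → m ℕ.< k′ → G-fuel k p m ≈ G-fuel k′ p m
        G-fuel-enough {suc k} {suc k′} p m (s≤s m≤k) (s≤s m≤k′) =
          act-cong _ (H-fuel-enough m (p %ℕ suc m) (ℤ÷.n%ℕd<d p (suc m)) m≤k m≤k′)

        H-fuel-enough : ∀ {k k′} m r → r ℕ.< suc m → m ℕ.≤ k → m ℕ.≤ k′ → H-fuel k m r ≈ H-fuel k′ m r
        H-fuel-enough m zero    _           _   _    = refl
        H-fuel-enough m (suc r) (s≤s r<m) m≤k m≤k′ =
          ∙-congˡ (act-cong σ (G-fuel-enough -[1+ m ] r (ℕP.<-≤-trans r<m m≤k) (ℕP.<-≤-trans r<m m≤k′)))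

      G⁺ : ℤ → ℕ → Carrier
      G⁺ p m = G-fuel (suc m) p m

      H : ℕ → ℕ → Carrier
      H m zero    = w
      H m (suc r) = w ∙ act σ (G⁺ -[1+ m ] r)

      G⁺-unfold : ∀ {p m n r} → r ℕ.< suc m → p ≡ + r + n * + suc m → G⁺ p m ≈ act (T^ n) (H m r)
      G⁺-unfold {p} {m} {n} {r} r<q p≡ = begin
        act (T^ (p /ℕ suc m)) (H-fuel m m (p %ℕ suc m))
          ≡⟨ cong₂ (λ k r → act (T^ k) (H-fuel m m r)) quotient≡n remainder≡r ⟩
        act (T^ n) (H-fuel m m r)  ≈⟨ act-cong (T^ n) (H-fuel≈H r r<q) ⟩
        act (T^ n) (H m r)         ∎
        where
        quotient≡n : p /ℕ suc m ≡ n
        quotient≡n = proj₁ (divmod-unique p (suc m) {n} {r} r<q p≡)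
        remainder≡r : p %ℕ suc m ≡ r
        remainder≡r = proj₂ (divmod-unique p (suc m) {n} {r} r<q p≡)
        H-fuel≈H : ∀ r → r ℕ.< suc m → H-fuel m m r ≈ H m r
        H-fuel≈H zero    _         = refl
        H-fuel≈H (suc r) (s≤s r<m) = ∙-congˡ (act-cong σ (G-fuel-enough -[1+ m ] r r<m (ℕP.n<1+n r)))

      G⁺-unfold-self : ∀ p m → G⁺ p m ≈ act (T^ (p /ℕ suc m)) (H m (p %ℕ suc m))
      G⁺-unfold-self p m = G⁺-unfold (ℤ÷.n%ℕd<d p (suc m)) (ℤ÷.a≡a%ℕn+[a/ℕn]*n p (suc m))

      G⁺-T^ : ∀ p m n → G⁺ (p + n * + suc m) m ≈ act (T^ n) (G⁺ p m)
      G⁺-T^ p m n = begin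
        G⁺ (p + n * + suc m) m         ≈⟨ G⁺-unfold r<q shifted ⟩
        act (T^ (n + k)) (H m r)       ≈⟨ act-≡ (H m r) (T^-+ n k) ⟩
        act (T^ n · T^ k) (H m r)      ≈⟨ act-comp (T^ n) (T^ k) (H m r) ⟩
        act (T^ n) (act (T^ k) (H m r)) ≈⟨ act-cong (T^ n) (G⁺-unfold-self p m) ⟨
        act (T^ n) (G⁺ p m)            ∎
        where
        k : ℤ
        k = p /ℕ suc m
        r : ℕ
        r = p %ℕ suc m
        r<q : r ℕ.< suc m
        r<q = ℤ÷.n%ℕd<d p (suc m)
        regroup : ∀ r k n q → r + k * q + n * q ≡ r + (n + k) * q
        regroup = solve-∀
        shifted : p + n * + suc m ≡ + r + (n + k) * + suc m
        shifted = ≡.trans (cong (_+ n * + suc m) (ℤ÷.a≡a%ℕn+[a/ℕn]*n p (suc m))) (regroup (+ r) k n (+ suc m))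

      G⁺-scale : ∀ m k p → G⁺ (+[1+ k ] * p) (m ℕ.+ k ℕ.* suc m) ≈ G⁺ p m
      G⁺-scale = <-rec (λ m → ∀ k p → G⁺ (+[1+ k ] * p) (m ℕ.+ k ℕ.* suc m) ≈ G⁺ p m) step
        where
        step : ∀ m → (∀ {j} → j ℕ.< m → ∀ k p → G⁺ (+[1+ k ] * p) (j ℕ.+ k ℕ.* suc j) ≈ G⁺ p j) →
               ∀ k p → G⁺ (+[1+ k ] * p) (m ℕ.+ k ℕ.* suc m) ≈ G⁺ p m
        step m ih k p = begin
          G⁺ (+[1+ k ] * p) m′             ≈⟨ G⁺-unfold (ℕP.*-monoʳ-< (suc k) r<q) scaled ⟩
          act (T^ n) (H m′ (suc k ℕ.* r))  ≈⟨ act-cong (T^ n) (H-scale r r<q) ⟩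
          act (T^ n) (H m r)               ≈⟨ G⁺-unfold-self p m ⟨
          G⁺ p m                           ∎
          where
          m′ r : ℕ
          m′ = m ℕ.+ k ℕ.* suc m
          r = p %ℕ suc m
          n : ℤ
          n = p /ℕ suc m
          r<q : r ℕ.< suc m
          r<q = ℤ÷.n%ℕd<d p (suc m)
          distrib : ∀ K r n q → K * (r + n * q) ≡ K * r + n * (K * q)
          distrib = solve-∀
          scaled : +[1+ k ] * p ≡ + (suc k ℕ.* r) + n * + suc m′
          scaled = ≡.trans (cong (+[1+ k ] *_) (ℤ÷.a≡a%ℕn+[a/ℕn]*n p (suc m)))
                   (≡.trans (distrib +[1+ k ] (+ r) n (+ suc m))
                            (cong (_+ n * + suc m′) (≡.sym (ℤP.pos-* (suc k) r))))
          H-scale : ∀ r → r ℕ.< suc m → H m′ (suc k ℕ.* r) ≈ H m r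
          H-scale zero     _          = reflexive (cong (H m′) (ℕP.*-zeroʳ (suc k)))
          H-scale (suc r′) (s≤s r′<m) = ∙-congˡ (act-cong σ (ih r′<m k -[1+ m ]))

      G⁺-minusI : act minusI w ≈ w → ∀ m p → act minusI (G⁺ p m) ≈ G⁺ p m
      G⁺-minusI w-fixed = <-rec (λ m → ∀ p → act minusI (G⁺ p m) ≈ G⁺ p m) step
        where
        step : ∀ m → (∀ {j} → j ℕ.< m → ∀ p → act minusI (G⁺ p j) ≈ G⁺ p j) →
               ∀ p → act minusI (G⁺ p m) ≈ G⁺ p m
        step m ih p = begin
          act minusI (G⁺ p m)                 ≈⟨ act-cong minusI (G⁺-unfold-self p m) ⟩
          act minusI (act (T^ n) (H m r))     ≈⟨ act-minusI-comm (T^ n) (H m r) ⟩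
          act (T^ n) (act minusI (H m r))     ≈⟨ act-cong (T^ n) (H-fixed r (ℤ÷.n%ℕd<d p (suc m))) ⟩
          act (T^ n) (H m r)                  ≈⟨ G⁺-unfold-self p m ⟨
          G⁺ p m                              ∎
          where
          n : ℤ
          n = p /ℕ suc m
          r : ℕ
          r = p %ℕ suc m
          H-fixed : ∀ r → r ℕ.< suc m → act minusI (H m r) ≈ H m r
          H-fixed zero     _          = w-fixed
          H-fixed (suc r′) (s≤s r′<m) = begin
            act minusI (w ∙ act σ (G⁺ -[1+ m ] r′))                  ≈⟨ act-hom minusI w _ ⟩
            act minusI w ∙ act minusI (act σ (G⁺ -[1+ m ] r′))       ≈⟨ ∙-cong w-fixed (act-minusI-comm σ _) ⟩
            w ∙ act σ (act minusI (G⁺ -[1+ m ] r′))                  ≈⟨ ∙-congˡ (act-cong σ (ih r′<m -[1+ m ])) ⟩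
            w ∙ act σ (G⁺ -[1+ m ] r′)                               ∎

      G⁺-0 : ∀ m → G⁺ 0ℤ m ≈ w
      G⁺-0 m = begin
        G⁺ 0ℤ m           ≈⟨ G⁺-unfold {0ℤ} {m} {0ℤ} {0} (s≤s z≤n) ≡.refl ⟩
        act (T^ 0ℤ) w     ≈⟨ act-≡ w T^0≡I ⟩
        act I w           ≈⟨ act-id w ⟩
        w                 ∎

      G : ℤ² → Carrier
      G (p , + 0)      = ε
      G (p , +[1+ m ]) = G⁺ p m
      G (p , -[1+ m ]) = G⁺ (- p) m

      G-neg : ∀ p q → G (- p , - q) ≈ G (p , q)
      G-neg p (+ 0)      = refl
      G-neg p +[1+ m ]   = reflexive (cong (λ t → G⁺ t m) (ℤP.neg-involutive p))
      G-neg p -[1+ m ]   = refl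

      G-scale⁺ : ∀ k p q → G (+[1+ k ] * p , +[1+ k ] * q) ≈ G (p , q)
      G-scale⁺ k p (+ 0)    = reflexive (cong (λ t → G (+[1+ k ] * p , t)) (ℤP.*-zeroʳ +[1+ k ]))
      G-scale⁺ k p +[1+ m ] = G⁺-scale m k p
      G-scale⁺ k p -[1+ m ] =
        trans (reflexive (cong (λ t → G⁺ t _) (ℤP.neg-distribʳ-* +[1+ k ] p))) (G⁺-scale m k (- p))

      G-scale : ∀ k p q → k ≢ 0ℤ → G (k * p , k * q) ≈ G (p , q)
      G-scale (+ 0)     _ _ k≢0 = ⊥-elim (k≢0 ≡.refl)
      G-scale +[1+ k ]  p q _   = G-scale⁺ k p q
      G-scale -[1+ k ]  p q _   = begin
        G (-[1+ k ] * p , -[1+ k ] * q)                ≡⟨ cong₂ (λ s t → G (s , t)) (ℤP.neg-distribˡ-* +[1+ k ] p)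
                                                                                (ℤP.neg-distribˡ-* +[1+ k ] q) ⟨
        G (- (+[1+ k ] * p) , - (+[1+ k ] * q))        ≈⟨ G-neg (+[1+ k ] * p) (+[1+ k ] * q) ⟩
        G (+[1+ k ] * p , +[1+ k ] * q)                ≈⟨ G-scale⁺ k p q ⟩
        G (p , q)                                      ∎

      G-proportional : ∀ p q p′ q′ → q ≢ 0ℤ → q′ ≢ 0ℤ → p * q′ ≡ p′ * q → G (p , q) ≈ G (p′ , q′)
      G-proportional p q p′ q′ q≢0 q′≢0 pq′≡p′q = begin
        G (p , q)              ≈⟨ G-scale q′ p q q′≢0 ⟨
        G (q′ * p , q′ * q)    ≡⟨ cong₂ (λ s t → G (s , t)) (≡.trans (ℤP.*-comm q′ p) (≡.trans pq′≡p′q (ℤP.*-comm p′ q)))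
                                                          (ℤP.*-comm q′ q) ⟩
        G (q * p′ , q * q′)    ≈⟨ G-scale q p′ q′ q≢0 ⟩
        G (p′ , q′)            ∎

      G-T^ : ∀ p q n → G (p + n * q , q) ≈ act (T^ n) (G (p , q))
      G-T^ p (+ 0)    n = sym (act-ε (T^ n))
      G-T^ p +[1+ m ] n = G⁺-T^ p m n
      G-T^ p -[1+ m ] n = trans (reflexive (cong (λ t → G⁺ t m) (negate p n (+ suc m)))) (G⁺-T^ (- p) m n)
        where
        negate : ∀ p n q → - (p + n * (- q)) ≡ - p + n * q
        negate = solve-∀

      G-minusI : act minusI w ≈ w → ∀ v → act minusI (G v) ≈ G v
      G-minusI w-fixed (p , + 0)      = act-ε minusI
      G-minusI w-fixed (p , +[1+ m ]) = G⁺-minusI w-fixed m p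
      G-minusI w-fixed (p , -[1+ m ]) = G⁺-minusI w-fixed m (- p)

      G-0 : ∀ q → q ≢ 0ℤ → G (0ℤ , q) ≈ w
      G-0 (+ 0)    q≢0 = ⊥-elim (q≢0 ≡.refl)
      G-0 +[1+ m ] _   = G⁺-0 m
      G-0 -[1+ m ] _   = G⁺-0 m

      G-Coords : ∀ α {v} → Coords α v → G (coords α) ≈ G v
      G-Coords (fin x) {p , q} (q≢0 , ratio cross) = G-proportional (↥ x) (↧ x) p q (↧≢0 x) q≢0 cross
      G-Coords ∞       (≡.refl , _)        = refl

    module _ {J : P1 → P1 → Carrier} (J-mpm : IsModularPseudoMeasure U A J)
             {w : Carrier} (J0∞≈w : J (0P U A) ∞ ≈ w) where
      open Euclid w
      open IsPseudoMeasure (proj₁ J-mpm)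
      open PseudoMeasure (proj₁ J-mpm)

      private
        modular : IsModular U A J
        modular = proj₂ J-mpm

        σ[J0∞]≈w⁻¹ : act σ (J (0P U A) ∞) ≈ w ⁻¹
        σ[J0∞]≈w⁻¹ = begin
          act σ (J (0P U A) ∞)  ≈⟨ modular σ (0P U A) ∞ ⟨
          J ∞ (0P U A)          ≈⟨ J-flip (0P U A) ∞ ⟩
          J (0P U A) ∞ ⁻¹       ≈⟨ ⁻¹-cong J0∞≈w ⟩
          w ⁻¹                  ∎

        J-toward-∞-T^ : ∀ {α p} m n → Coords α (p , +[1+ m ]) → p ≡ 0ℤ + n * + suc m → J α ∞ ≈ act (T^ n) w
        J-toward-∞-T^ {α} {p} m n α-coords p≡ = begin
          J α ∞                                  ≡⟨ cong (λ β → J β ∞) α≡T^n0 ⟩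
          J (T^ n ⊙ 0P U A) (T^ n ⊙ ∞)           ≈⟨ modular (T^ n) (0P U A) ∞ ⟩
          act (T^ n) (J (0P U A) ∞)              ≈⟨ act-cong (T^ n) J0∞≈w ⟩
          act (T^ n) w                           ∎
          where
          cross : ∀ p n q → p ≡ 0ℤ + n * q → p * (0ℤ * 0ℤ + 1ℤ * 1ℤ) ≡ (1ℤ * 0ℤ + n * 1ℤ) * q
          cross _ n q ≡.refl = expand n q
            where
            expand : ∀ n q → (0ℤ + n * q) * (0ℤ * 0ℤ + 1ℤ * 1ℤ) ≡ (1ℤ * 0ℤ + n * 1ℤ) * q
            expand = solve-∀
          α≡T^n0 : α ≡ T^ n ⊙ 0P U A
          α≡T^n0 = Coords-unique α (T^ n ⊙ 0P U A) α-coords (⊙-Coords (T^ n) (0P U A) (coords-Coords (0P U A)))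
                     (cross p n (+ suc m) p≡)

        J-toward-∞-T^σ : ∀ {α p} m n r′ → Coords α (p , +[1+ m ]) → p ≡ +[1+ r′ ] + n * + suc m →
                         ∀ {x} → J (frac (ℤ→ℚ -[1+ m ]) (ℤ→ℚ +[1+ r′ ])) ∞ ≈ x → J α ∞ ≈ act (T^ n) (w ∙ act σ x)
        J-toward-∞-T^σ {α} {p} m n r′ α-coords p≡ {x} Jγ∞≈x = begin
          J α ∞                                            ≡⟨ cong (λ β → J β ∞) α≡T^nσγ ⟩
          J (T^ n ⊙ (σ ⊙ γ)) (T^ n ⊙ (σ ⊙ 0P U A))         ≈⟨ modular (T^ n) (σ ⊙ γ) (σ ⊙ 0P U A) ⟩
          act (T^ n) (J (σ ⊙ γ) (σ ⊙ 0P U A))              ≈⟨ act-cong (T^ n) (modular σ γ (0P U A)) ⟩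
          act (T^ n) (act σ (J γ (0P U A)))                ≈⟨ act-cong (T^ n) (act-cong σ (J-via γ (0P U A) ∞)) ⟩
          act (T^ n) (act σ (J (0P U A) ∞ \\ J γ ∞))       ≈⟨ act-cong (T^ n) (act-\\ σ (J (0P U A) ∞) (J γ ∞)) ⟩
          act (T^ n) (act σ (J (0P U A) ∞) \\ act σ (J γ ∞))
            ≈⟨ act-cong (T^ n) (∙-cong (trans (⁻¹-cong σ[J0∞]≈w⁻¹) (⁻¹-involutive w)) (act-cong σ Jγ∞≈x)) ⟩
          act (T^ n) (w ∙ act σ x)                         ∎
          where
          γ : P1
          γ = frac (ℤ→ℚ -[1+ m ]) (ℤ→ℚ +[1+ r′ ])
          cross : ∀ p R n q → p ≡ R + n * q →
                  p * (0ℤ * (0ℤ * (- q) + -1ℤ * R) + 1ℤ * (1ℤ * (- q) + 0ℤ * R))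
                  ≡ (1ℤ * (0ℤ * (- q) + -1ℤ * R) + n * (1ℤ * (- q) + 0ℤ * R)) * q
          cross _ R n q ≡.refl = expand R n q
            where
            expand : ∀ R n q → (R + n * q) * (0ℤ * (0ℤ * (- q) + -1ℤ * R) + 1ℤ * (1ℤ * (- q) + 0ℤ * R))
                               ≡ (1ℤ * (0ℤ * (- q) + -1ℤ * R) + n * (1ℤ * (- q) + 0ℤ * R)) * q
            expand = solve-∀
          α≡T^nσγ : α ≡ T^ n ⊙ (σ ⊙ γ)
          α≡T^nσγ = Coords-unique α (T^ n ⊙ (σ ⊙ γ)) α-coords
                      (⊙-Coords (T^ n) (σ ⊙ γ) (⊙-Coords σ γ (frac-ℤ-Coords -[1+ m ] +[1+ r′ ] (λ ()))))
                      (cross p +[1+ r′ ] n (+ suc m) p≡)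

        -- J(α,∞) satisfies the recursion defining G⁺: modularity moves along Tⁿ and σ,
        -- and the cocycle relation passes through 0.
        J-toward-∞ : ∀ m p α → Coords α (p , +[1+ m ]) → J α ∞ ≈ G⁺ p m
        J-toward-∞ = <-rec (λ m → ∀ p α → Coords α (p , +[1+ m ]) → J α ∞ ≈ G⁺ p m) step
          where
          step : ∀ m → (∀ {j} → j ℕ.< m → ∀ p α → Coords α (p , +[1+ j ]) → J α ∞ ≈ G⁺ p j) →
                 ∀ p α → Coords α (p , +[1+ m ]) → J α ∞ ≈ G⁺ p m
          step m ih p α α-coords = trans (by-remainder (p %ℕ suc m) (ℤ÷.n%ℕd<d p (suc m)) (ℤ÷.a≡a%ℕn+[a/ℕn]*n p (suc m)))
                                         (sym (G⁺-unfold-self p m))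
            where
            by-remainder : ∀ r → r ℕ.< suc m → p ≡ + r + (p /ℕ suc m) * + suc m →
                           J α ∞ ≈ act (T^ (p /ℕ suc m)) (H m r)
            by-remainder zero      _          p≡ = J-toward-∞-T^ m _ α-coords p≡
            by-remainder (suc r′) (s≤s r′<m) p≡ =
              J-toward-∞-T^σ m _ r′ α-coords p≡ (ih r′<m -[1+ m ] _ (frac-ℤ-Coords -[1+ m ] +[1+ r′ ] (λ ())))

      J-toward-∞≈G : ∀ α → J α ∞ ≈ G (coords α)
      J-toward-∞≈G (fin x) = J-toward-∞ _ (↥ x) (fin x) (coords-Coords (fin x))
      J-toward-∞≈G ∞       = refl-1 ∞

      modular-determined : ∀ α β → J α β ≈ G (coords β) \\ G (coords α)
      modular-determined α β = trans (J-via α β ∞) (∙-cong (⁻¹-cong (J-toward-∞≈G β)) (J-toward-∞≈G α))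

    module _ {u : Carrier} (u∈fiber : InFiber U A u) where
      private
        u-fixed : act minusI u ≈ u
        u-fixed = proj₁ u∈fiber

        σ-relation : act σ u ∙ u ≈ ε
        σ-relation = proj₁ (proj₂ u∈fiber)

        τ-relation : act (τ · τ) u ∙ act τ u ∙ u ≈ ε
        τ-relation = proj₂ (proj₂ u∈fiber)

        w : Carrier
        w = u ⁻¹

      open Euclid w

      private
        w-fixed : act minusI w ≈ w
        w-fixed = trans (act-⁻¹ minusI u) (⁻¹-cong u-fixed)

        w∙σ[w]≈ε : w ∙ act σ w ≈ ε
        w∙σ[w]≈ε = begin
          w ∙ act σ (u ⁻¹)     ≈⟨ ∙-congˡ (act-⁻¹ σ u) ⟩
          w ∙ act σ u ⁻¹       ≈⟨ ∙-congˡ (⁻¹-cong (inverseˡ-unique (act σ u) u σ-relation)) ⟩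
          w ∙ w ⁻¹             ≈⟨ inverseʳ w ⟩
          ε                    ∎

        w-τ-cycle : w ∙ act τ w ∙ act (τ · τ) w ≈ ε
        w-τ-cycle = begin
          u ⁻¹ ∙ act τ (u ⁻¹) ∙ act (τ · τ) (u ⁻¹)   ≈⟨ ∙-cong (∙-congˡ (act-⁻¹ τ u)) (act-⁻¹ (τ · τ) u) ⟩
          u ⁻¹ ∙ act τ u ⁻¹ ∙ act (τ · τ) u ⁻¹       ≈⟨ ∙-congʳ (⁻¹-anti-homo-∙ (act τ u) u) ⟨
          (act τ u ∙ u) ⁻¹ ∙ act (τ · τ) u ⁻¹        ≈⟨ ⁻¹-anti-homo-∙ (act (τ · τ) u) (act τ u ∙ u) ⟨
          (act (τ · τ) u ∙ (act τ u ∙ u)) ⁻¹         ≈⟨ ⁻¹-cong (assoc (act (τ · τ) u) (act τ u) u) ⟨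
          (act (τ · τ) u ∙ act τ u ∙ u) ⁻¹           ≈⟨ ⁻¹-cong τ-relation ⟩
          ε ⁻¹                                       ≈⟨ ε⁻¹≈ε ⟩
          ε                                          ∎

        σ-law : ℤ² → Set ℓ
        σ-law (p , q) = G (- q , p) ≈ w ∙ act σ (G (p , q))

        τ-law : ℤ² → Set ℓ
        τ-law (p , q) = G (- q , p - q) ≈ w ∙ act τ (G (p , q))

        -- σ² = −I acts trivially on the values of G because w ∈ U₊.
        σ-law-σ : ∀ p q → σ-law (p , q) → σ-law (- q , p)
        σ-law-σ p q law = begin
          G (- p , - q)                          ≈⟨ G-neg p q ⟩
          G (p , q)                              ≈⟨ G-minusI w-fixed (p , q) ⟨
          act minusI (G (p , q))                 ≈⟨ act-≡ (G (p , q)) σ·σ≡minusI ⟨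
          act (σ · σ) (G (p , q))                ≈⟨ act-comp σ σ (G (p , q)) ⟩
          act σ (act σ (G (p , q)))              ≈⟨ identityˡ _ ⟨
          ε ∙ act σ (act σ (G (p , q)))          ≈⟨ ∙-congʳ w∙σ[w]≈ε ⟨
          w ∙ act σ w ∙ act σ (act σ (G (p , q))) ≈⟨ assoc w (act σ w) _ ⟩
          w ∙ (act σ w ∙ act σ (act σ (G (p , q)))) ≈⟨ ∙-congˡ (act-hom σ w _) ⟨
          w ∙ act σ (w ∙ act σ (G (p , q)))      ≈⟨ ∙-congˡ (act-cong σ law) ⟨
          w ∙ act σ (G (- q , p))                ∎

        σ-law-neg : ∀ p q → σ-law (p , q) → σ-law (- p , - q)
        σ-law-neg p q law = begin
          G (- - q , - p)              ≈⟨ G-neg (- q) p ⟩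
          G (- q , p)                  ≈⟨ law ⟩
          w ∙ act σ (G (p , q))        ≈⟨ ∙-congˡ (act-cong σ (G-neg p q)) ⟨
          w ∙ act σ (G (- p , - q))    ∎

        σ-law-∞ : ∀ p → p ≢ 0ℤ → σ-law (p , 0ℤ)
        σ-law-∞ p p≢0 = begin
          G (0ℤ , p)       ≈⟨ G-0 p p≢0 ⟩
          w                ≈⟨ identityʳ w ⟨
          w ∙ ε            ≈⟨ ∙-congˡ (act-ε σ) ⟨
          w ∙ act σ ε      ∎

        σ-law-unit-interval : ∀ p m → p ℕ.≤ m → σ-law (+ p , +[1+ m ])
        σ-law-unit-interval zero     m _      = σ-law-σ +[1+ m ] 0ℤ (σ-law-∞ +[1+ m ] (λ ()))
        σ-law-unit-interval (suc p′) m p′<m =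
          σ-law-neg -[1+ p′ ] -[1+ m ] (σ-law-σ -[1+ m ] +[1+ p′ ] (begin
            G⁺ +[1+ p′ ] m                    ≈⟨ G⁺-unfold {n = 0ℤ} (s≤s p′<m) (plus-zero +[1+ p′ ] (+ suc m)) ⟩
            act (T^ 0ℤ) (H m (suc p′))        ≈⟨ act-≡ _ T^0≡I ⟩
            act I (H m (suc p′))              ≈⟨ act-id _ ⟩
            w ∙ act σ (G⁺ -[1+ m ] p′)        ∎))
          where
          plus-zero : ∀ p q → p ≡ p + 0ℤ * q
          plus-zero = solve-∀

        σ∘T⁻¹≈τ : ∀ p q → act σ (G (p - q , q)) ≈ act τ (G (p , q))
        σ∘T⁻¹≈τ p q = begin
          act σ (G (p - q , q))                ≡⟨ cong (λ t → act σ (G (t , q))) (minus p q) ⟩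
          act σ (G (p + -1ℤ * q , q))          ≈⟨ act-cong σ (G-T^ p q -1ℤ) ⟩
          act σ (act (T^ -1ℤ) (G (p , q)))     ≈⟨ act-comp σ (T^ -1ℤ) _ ⟨
          act (σ · T^ -1ℤ) (G (p , q))         ≈⟨ act-≡ _ σ·T⁻¹≡τ ⟩
          act τ (G (p , q))                    ∎
          where
          minus : ∀ p q → p - q ≡ p + -1ℤ * q
          minus = solve-∀

        σ-law⇒τ-law : ∀ p q → σ-law (p - q , q) → τ-law (p , q)
        σ-law⇒τ-law p q law = trans law (∙-congˡ (σ∘T⁻¹≈τ p q))

        τ-law⇒σ-law : ∀ p q → τ-law (p , q) → σ-law (p - q , q)
        τ-law⇒σ-law p q law = trans law (∙-congˡ (sym (σ∘T⁻¹≈τ p q)))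

        -- τ³ = I together with w ∙ τ[w] ∙ τ²[w] = 1.
        τ-law-τ² : ∀ a b → τ-law (a , b) → τ-law (- b , a - b) → τ-law (- (a - b) , - b - (a - b))
        τ-law-τ² a b law₀ law₁ = begin
          G (- (- b - (a - b)) , - (a - b) - (- b - (a - b)))   ≡⟨ cong₂ (λ s t → G (s , t)) (τ³-fst a b) (τ³-snd a b) ⟩
          X₀                                                    ≈⟨ identityˡ X₀ ⟨
          ε ∙ X₀                                                ≈⟨ ∙-congʳ w-τ-cycle ⟨
          w ∙ act τ w ∙ act (τ · τ) w ∙ X₀                      ≈⟨ assoc (w ∙ act τ w) (act (τ · τ) w) X₀ ⟩
          w ∙ act τ w ∙ (act (τ · τ) w ∙ X₀)                    ≈⟨ assoc w (act τ w) _ ⟩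
          w ∙ (act τ w ∙ (act (τ · τ) w ∙ X₀))                  ≈⟨ ∙-congˡ (∙-congˡ (∙-congˡ τ³[X₀]≈X₀)) ⟨
          w ∙ (act τ w ∙ (act (τ · τ) w ∙ act (τ · τ) (act τ X₀))) ≈⟨ ∙-congˡ (∙-congˡ (act-hom (τ · τ) w _)) ⟨
          w ∙ (act τ w ∙ act (τ · τ) (w ∙ act τ X₀))            ≈⟨ ∙-congˡ (∙-congˡ (act-cong (τ · τ) law₀)) ⟨
          w ∙ (act τ w ∙ act (τ · τ) X₁)                        ≈⟨ ∙-congˡ (∙-congˡ (act-comp τ τ X₁)) ⟩
          w ∙ (act τ w ∙ act τ (act τ X₁))                      ≈⟨ ∙-congˡ (act-hom τ w _) ⟨
          w ∙ act τ (w ∙ act τ X₁)                              ≈⟨ ∙-congˡ (act-cong τ law₁) ⟨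
          w ∙ act τ (G (- (a - b) , - b - (a - b)))             ∎
          where
          X₀ X₁ : Carrier
          X₀ = G (a , b)
          X₁ = G (- b , a - b)
          τ³-fst : ∀ a b → - (- b - (a - b)) ≡ a
          τ³-fst = solve-∀
          τ³-snd : ∀ a b → - (a - b) - (- b - (a - b)) ≡ b
          τ³-snd = solve-∀
          τ³[X₀]≈X₀ : act (τ · τ) (act τ X₀) ≈ X₀
          τ³[X₀]≈X₀ = trans (sym (act-comp (τ · τ) τ X₀)) (trans (act-≡ X₀ τ³≡I) (act-id X₀))

        -- For x = P/Q ∈ [−1,0), Tx is τ² of τ(Tx) = −Q/P, and the τ-laws at −Q/P and
        -- τ(−Q/P) reduce to σ-laws at D/(r+1) and −(m+1)/D, where D = m − r; each of these
        -- points lies in [0,1) or has denominator smaller than Q.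
        σ-law-neg-unit-interval : ∀ m r → r ℕ.≤ m → σ-law (-[1+ r ] , +[1+ m ])
        σ-law-neg-unit-interval = <-rec (λ m → ∀ r → r ℕ.≤ m → σ-law (-[1+ r ] , +[1+ m ])) step
          where
          step : ∀ m → (∀ {j} → j ℕ.< m → ∀ r → r ℕ.≤ j → σ-law (-[1+ r ] , +[1+ j ])) →
                 ∀ r → r ℕ.≤ m → σ-law (-[1+ r ] , +[1+ m ])
          step m ih r r≤m =
            subst σ-law (cong (_, Q) (cancel P Q))
              (τ-law⇒σ-law (P + Q) Q (subst τ-law (cong₂ _,_ (negate-sum Q P) (swap P Q)) (τ-law-τ² (- Q) P law₀ law₁)))
            where
            P Q D : ℤ
            P = -[1+ r ]
            Q = +[1+ m ]
            D = + (m ℕ.∸ r)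
            cancel : ∀ P Q → P + Q - Q ≡ P
            cancel = solve-∀
            negate-sum : ∀ Q P → - (- Q - P) ≡ P + Q
            negate-sum = solve-∀
            swap : ∀ P Q → - P - (- Q - P) ≡ Q
            swap = solve-∀
            -Q-P≡-D : - Q - P ≡ - D
            -Q-P≡-D = ≡.trans (≡.sym (ℤP.neg-distrib-+ Q P))
                              (cong -_ (≡.trans (ℤP.[1+m]⊖[1+n]≡m⊖n m r) (ℤP.⊖-≥ r≤m)))
            σ-law-d/[1+r] : ∀ d → d ℕ.≤ m → σ-law (+ d , +[1+ r ])
            σ-law-d/[1+r] d d≤m with d ℕ.≤? r
            ... | yes d≤r = σ-law-unit-interval d r d≤r
            σ-law-d/[1+r] zero      _    | no d≰r = ⊥-elim (d≰r z≤n)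
            σ-law-d/[1+r] (suc d′) d′<m | no d≰r =
              σ-law-σ +[1+ r ] -[1+ d′ ] (σ-law-neg -[1+ r ] +[1+ d′ ] (ih d′<m r (ℕP.≤-pred (ℕP.≰⇒> d≰r))))
            σ-law-[-1-m]/d : ∀ d → d ℕ.≤ m → σ-law (-[1+ m ] , + d)
            σ-law-[-1-m]/d zero     _    = σ-law-∞ -[1+ m ] (λ ())
            σ-law-[-1-m]/d (suc d′) d≤m  = σ-law-σ +[1+ d′ ] +[1+ m ] (σ-law-unit-interval (suc d′) m d≤m)
            law₀ : τ-law (- Q , P)
            law₀ = σ-law⇒τ-law (- Q) P (subst σ-law (cong (_, P) (≡.sym -Q-P≡-D))
                                         (σ-law-neg D +[1+ r ] (σ-law-d/[1+r] (m ℕ.∸ r) (ℕP.m∸n≤m m r))))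
            law₁ : τ-law (- P , - Q - P)
            law₁ = σ-law⇒τ-law (- P) (- Q - P) (subst σ-law (cong₂ _,_ (≡.sym (swap P Q)) (≡.sym -Q-P≡-D))
                                                  (σ-law-neg -[1+ m ] D (σ-law-[-1-m]/d (m ℕ.∸ r) (ℕP.m∸n≤m m r))))

        σ-law-positive-denominator : ∀ p m → σ-law (p , +[1+ m ])
        σ-law-positive-denominator (+ p) m with p ℕ.≤? m
        ... | yes p≤m = σ-law-unit-interval p m p≤m
        σ-law-positive-denominator (+ zero)    m | no p≰m = ⊥-elim (p≰m z≤n)
        σ-law-positive-denominator +[1+ p′ ]   m | no p≰m =
          σ-law-σ +[1+ m ] -[1+ p′ ] (σ-law-neg -[1+ m ] +[1+ p′ ]
            (σ-law-neg-unit-interval p′ m (ℕP.≤-pred (ℕP.≰⇒> p≰m))))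
        σ-law-positive-denominator -[1+ r ] m with r ℕ.≤? m
        ... | yes r≤m = σ-law-neg-unit-interval m r r≤m
        ... | no r≰m  = σ-law-σ +[1+ m ] +[1+ r ] (σ-law-unit-interval (suc m) r (ℕP.≰⇒> r≰m))

        σ-law-all : ∀ p q → NonZero² (p , q) → σ-law (p , q)
        σ-law-all p (+ 0)    pq≢0 = σ-law-∞ p (λ p≡0 → pq≢0 (p≡0 , ≡.refl))
        σ-law-all p +[1+ m ] _    = σ-law-positive-denominator p m
        σ-law-all p -[1+ m ] _    =
          subst σ-law (cong (_, -[1+ m ]) (ℤP.neg-involutive p)) (σ-law-neg (- p) +[1+ m ] (σ-law-positive-denominator (- p) m))

        TransformsBy : SL2Z → Carrier → Set ℓ
        TransformsBy g k = ∀ v → NonZero² v → G (g ⊛ v) ≈ k ∙ act g (G v)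

        σ-transforms : TransformsBy σ w
        σ-transforms (p , q) pq≢0 =
          trans (reflexive (cong₂ (λ s t → G (s , t)) (σ-fst p q) (σ-snd p q))) (σ-law-all p q pq≢0)
          where
          σ-fst : ∀ p q → 0ℤ * p + -1ℤ * q ≡ - q
          σ-fst = solve-∀
          σ-snd : ∀ p q → 1ℤ * p + 0ℤ * q ≡ p
          σ-snd = solve-∀

        T^-transforms : ∀ n → TransformsBy (T^ n) ε
        T^-transforms n (p , q) _ = begin
          G (1ℤ * p + n * q , 0ℤ * p + 1ℤ * q)  ≡⟨ cong₂ (λ s t → G (s , t)) (T^-fst p q) (T^-snd p q) ⟩
          G (p + n * q , q)                     ≈⟨ G-T^ p q n ⟩
          act (T^ n) (G (p , q))                ≈⟨ identityˡ _ ⟨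
          ε ∙ act (T^ n) (G (p , q))            ∎
          where
          T^-fst : ∀ p q → 1ℤ * p + n * q ≡ p + n * q
          T^-fst p q = ≡.cong (_+ n * q) (ℤP.*-identityˡ p)
          T^-snd : ∀ p q → 0ℤ * p + 1ℤ * q ≡ q
          T^-snd = solve-∀

        CocycleAt : SL2Z → Set ℓ
        CocycleAt g = TransformsBy g (G (g ⊛ (1ℤ , 0ℤ)))

        I-cocycle : CocycleAt I
        I-cocycle (p , q) _ = begin
          G (1ℤ * p + 0ℤ * q , 0ℤ * p + 1ℤ * q)  ≡⟨ cong₂ (λ s t → G (s , t)) (I-fst p q) (I-snd p q) ⟩
          G (p , q)                              ≈⟨ act-id (G (p , q)) ⟨
          act I (G (p , q))                      ≈⟨ identityˡ _ ⟨
          ε ∙ act I (G (p , q))                  ∎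
          where
          I-fst : ∀ p q → 1ℤ * p + 0ℤ * q ≡ p
          I-fst = solve-∀
          I-snd : ∀ p q → 0ℤ * p + 1ℤ * q ≡ q
          I-snd = solve-∀

        ·-cocycle : ∀ s k h → TransformsBy s k → CocycleAt h → CocycleAt (s · h)
        ·-cocycle s k h s-transforms h-cocycle v v≢0 = begin
          G ((s · h) ⊛ v)                                     ≡⟨ cong G (·-⊛ s h v) ⟩
          G (s ⊛ (h ⊛ v))                                     ≈⟨ s-transforms (h ⊛ v) (⊛-NonZero² h v≢0) ⟩
          k ∙ act s (G (h ⊛ v))                               ≈⟨ ∙-congˡ (act-cong s (h-cocycle v v≢0)) ⟩
          k ∙ act s (G (h ⊛ e₁) ∙ act h (G v))                ≈⟨ ∙-congˡ (act-hom s (G (h ⊛ e₁)) _) ⟩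
          k ∙ (act s (G (h ⊛ e₁)) ∙ act s (act h (G v)))      ≈⟨ assoc k _ _ ⟨
          k ∙ act s (G (h ⊛ e₁)) ∙ act s (act h (G v))        ≈⟨ ∙-cong transforms-e₁ (act-comp s h (G v)) ⟨
          G ((s · h) ⊛ e₁) ∙ act (s · h) (G v)                ∎
          where
          e₁ : ℤ²
          e₁ = 1ℤ , 0ℤ
          transforms-e₁ : G ((s · h) ⊛ e₁) ≈ k ∙ act s (G (h ⊛ e₁))
          transforms-e₁ = trans (reflexive (cong G (·-⊛ s h e₁))) (s-transforms (h ⊛ e₁) (⊛-NonZero² h (λ { (() , _) })))

        cocycle : ∀ g → CocycleAt g
        cocycle = SL2Z-generated CocycleAt I-cocycle
                    (λ n h → ·-cocycle (T^ n) ε h (T^-transforms n)) (λ h → ·-cocycle σ w h σ-transforms)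

      J-from-fiber : P1 → P1 → Carrier
      J-from-fiber α β = G (coords β) \\ G (coords α)

      J-from-fiber-isModular : IsModular U A J-from-fiber
      J-from-fiber-isModular g α β = begin
        G (coords (g ⊙ β)) \\ G (coords (g ⊙ α))      ≈⟨ \\-cong₂ (transforms β) (transforms α) ⟩
        (k ∙ act g (G (coords β))) \\ (k ∙ act g (G (coords α)))  ≈⟨ \\-cancelˡ k _ _ ⟩
        act g (G (coords β)) \\ act g (G (coords α))  ≈⟨ act-\\ g _ _ ⟨
        act g (G (coords β) \\ G (coords α))          ∎
        where
        k : Carrier
        k = G (g ⊛ (1ℤ , 0ℤ))
        transforms : ∀ α → G (coords (g ⊙ α)) ≈ k ∙ act g (G (coords α))
        transforms α = trans (G-Coords (g ⊙ α) (⊙-Coords g α (coords-Coords α)))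
                             (cocycle g (coords α) (Coords⇒NonZero² α (coords-Coords α)))

      J-from-fiber-∞0 : J-from-fiber ∞ (0P U A) ≈ u
      J-from-fiber-∞0 = begin
        G (0ℤ , 1ℤ) ⁻¹ ∙ ε   ≈⟨ identityʳ _ ⟩
        G (0ℤ , 1ℤ) ⁻¹       ≈⟨ ⁻¹-cong (G⁺-0 0) ⟩
        u ⁻¹ ⁻¹              ≈⟨ ⁻¹-involutive u ⟩
        u                    ∎

    eval-injective : ∀ J J′ → IsModularPseudoMeasure U A J → IsModularPseudoMeasure U A J′ →
                     J ∞ (0P U A) ≈ J′ ∞ (0P U A) → ∀ α β → J α β ≈ J′ α β
    eval-injective J J′ J-mpm@(J-pm , _) J′-mpm@(J′-pm , _) J∞0≈J′∞0 α β =
      trans (modular-determined J-mpm refl α β) (sym (modular-determined J′-mpm J′0∞≈J0∞ α β))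
      where
      J′0∞≈J0∞ : J′ (0P U A) ∞ ≈ J (0P U A) ∞
      J′0∞≈J0∞ = begin
        J′ (0P U A) ∞        ≈⟨ PseudoMeasure.J-flip J′-pm ∞ (0P U A) ⟩
        J′ ∞ (0P U A) ⁻¹     ≈⟨ ⁻¹-cong J∞0≈J′∞0 ⟨
        J ∞ (0P U A) ⁻¹      ≈⟨ PseudoMeasure.J-flip J-pm ∞ (0P U A) ⟨
        J (0P U A) ∞         ∎

    eval-surjective : ∀ u → InFiber U A u →
                      Σ (P1 → P1 → Carrier) λ J → IsModularPseudoMeasure U A J × J ∞ (0P U A) ≈ u
    eval-surjective u u∈fiber =
      J-from-fiber u∈fiber , (coboundary-isPseudoMeasure _ , J-from-fiber-isModular u∈fiber) , J-from-fiber-∞0 u∈fiber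

open ModularPseudoMeasures using (J∞0-inFiber; eval-injective; eval-surjective)

theorem4p7 : ∀ {c ℓ : Level} (U : Group c ℓ) (A : SL2ZAction U) → EvalIsBijection U A
theorem4p7 U A = J∞0-inFiber U A , eval-injective U A , eval-surjective U A
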